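{- Let $k\ge 1$ be an integer and let $G$ be an edge-colored complete graph of order $n$. If $\delta^c(G)\geq \frac{n+k}{2}$, then every vertex of $G$ is contained in at least $k$ rainbow triangles.
   Context: Graphs are finite and simple. An edge-coloring of $G$ is a map $c:E(G)\to\mathbb{N}$; adjacent edges may receive the same color. The color-degree $d^c_G(v)$ of a vertex $v$ is the number of distinct colors on edges incident to $v$, and $\delta^c(G)=\min_{v\in V(G)} d^c_G(v)$ is the minimum color-degree. A subgraph is rainbow if all its edges have pairwise distinct colors; a rainbow triangle is a triangle whose three edges have three distinct colors. Distinct triangles are counted as distinct vertex sets. -}

module Defs where

open import Data.Nat using (ℕ; _<_; _≤_; _+_; _*_)
open import Data.Nat.Properties using (_≟_)
open import Data.Fin using (Fin; toℕ)
open import Data.Fin.Properties as FinP using ()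
open import Data.List using (List; length; filter; map; concatMap; deduplicate)
open import Data.List using (allFin)
open import Data.Product using (_×_; _,_; proj₁; proj₂)
open import Relation.Nullary using (¬_)
open import Relation.Nullary.Decidable using (¬?; _×-dec_)
open import Relation.Binary.PropositionalEquality using (_≡_)

-- An edge-coloring of the complete graph K_n on vertex set Fin n:
-- a function c with c u v the color of edge uv (only used for u ≠ v),
-- required to be symmetric so that it is a function on edges.
record EdgeColoring (n : ℕ) : Set where
  field
    col : Fin n → Fin n → ℕ
    sym : ∀ u v → ¬ (u ≡ v) → col u v ≡ col v u
open EdgeColoring public

others : ∀ {n} → Fin n → List (Fin n)
others {n} v = filter (λ u → ¬? (u FinP.≟ v)) (allFin n)

colorDegree : ∀ {n} → EdgeColoring n → Fin n → ℕ
colorDegree c v = length (deduplicate _≟_ (map (col c v) (others v)))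

rainbowTrianglesAt : ∀ {n} → EdgeColoring n → Fin n → ℕ
rainbowTrianglesAt {n} c v =
  length (filter (λ p → let u = proj₁ p ; w = proj₂ p in
                   (toℕ u Data.Nat.<? toℕ w) ×-dec
                   ((¬? (col c v u ≟ col c v w)) ×-dec
                    ((¬? (col c v u ≟ col c u w)) ×-dec
                     (¬? (col c v w ≟ col c u w)))))
         (concatMap (λ u → map (u ,_) (others v)) (others v)))

module Submission where

-- Fix v, and call a vertex u ≠ v lone when the colour of vu occurs on no other edge at v.
-- With t lone vertices and p colours repeated at v we get d(v) ≤ t + p and n ≥ t + 2p + 1.
-- For lone u, every colour at u is that of uv, or that of uw with uvw rainbow, or the colour
-- of vw copied onto uw; in the last case either w is lone or c(vw) is one of the p repeated
-- colours. Summing d(u) ≥ (n + k)/2 over the lone u therefore bounds t(n + k) by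
-- 2t(1 + p) plus twice the number of rainbow or copying pairs (u, w). For two lone vertices
-- u, w at most one of "uvw is rainbow", "uw copies vw", "wu copies vu" holds, so twice
-- that number is at most t(t − 1) + 2R, where R counts rainbow triangles at v. Together with
-- n ≥ t + 2p + 1 this gives tk ≤ 2R, and since n + k ≤ 2(t + p) forces t ≥ k + 1 ≥ 2, R ≥ k.

open import Defs hiding (sym)
open import Data.Nat using (ℕ; suc; _+_; _*_; _≤_; _<_; z≤n; s≤s; _≤?_; _<?_)
open import Data.Nat.Properties
open import Data.Nat.Tactic.RingSolver using (solve-∀)
open import Data.Fin using (Fin; toℕ)
import Data.Fin.Properties as Fin
open import Data.List using (List; []; _∷_; length; map; filter; _++_; concatMap; allFin; deduplicate)
open import Data.List.Properties using (length-map; length-++; length-tabulate; filter-none; filter-some; filter-notAll)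
open import Data.List.Membership.Propositional using (_∈_)
open import Data.List.Membership.Propositional.Properties
open import Data.List.Relation.Unary.Any as Any using (here; there)
open import Data.List.Relation.Unary.AllPairs using ([]; _∷_)
open import Data.List.Relation.Unary.Unique.Propositional using (Unique)
open import Data.List.Relation.Unary.Unique.DecPropositional.Properties using (deduplicate-!)
open import Data.Bool using (if_then_else_)
open import Data.Product using (_×_; _,_; proj₂)
open import Data.Sum using (_⊎_; inj₁; inj₂)
open import Function using (_∘_; id)
open import Relation.Nullary using (Dec; yes; no; does; ¬_; contradiction)
open import Relation.Nullary.Decidable using (¬?; _×-dec_; _⊎-dec_; decidable-stable)
open import Relation.Unary using (Pred; Decidable)
open import Relation.Binary.Definitions using (DecidableEquality; tri<; tri≈; tri>)
open import Relation.Binary.PropositionalEquality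

χ : ∀ {p} {P : Set p} → Dec P → ℕ
χ d = if does d then 1 else 0

module _ {p} {P : Set p} where

  χ-yes : (d : Dec P) → P → χ d ≡ 1
  χ-yes (yes _) _ = refl
  χ-yes (no ¬p) p = contradiction p ¬p

  χ-no : (d : Dec P) → ¬ P → χ d ≡ 0
  χ-no (yes p) ¬p = contradiction p ¬p
  χ-no (no _) _ = refl

  χ≤1 : (d : Dec P) → χ d ≤ 1
  χ≤1 (yes _) = s≤s z≤n
  χ≤1 (no _) = z≤n

  χ*χ : (d : Dec P) → χ d * χ d ≡ χ d
  χ*χ (yes _) = refl
  χ*χ (no _) = refl

  χ-*-mono : (d : Dec P) {x y : ℕ} → (P → x ≤ y) → χ d * x ≤ χ d * y
  χ-*-mono (yes p) x≤y = +-monoˡ-≤ 0 (x≤y p)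
  χ-*-mono (no _) _ = z≤n

module _ {p q} {P : Set p} {Q : Set q} where

  χ-× : (d : Dec P) (e : Dec Q) → χ (d ×-dec e) ≡ χ d * χ e
  χ-× (yes _) (yes _) = refl
  χ-× (yes _) (no _) = refl
  χ-× (no _) _ = refl

  χ-⊎ : (d : Dec P) (e : Dec Q) → (P → ¬ Q) → χ (d ⊎-dec e) ≡ χ d + χ e
  χ-⊎ (yes p) (yes q) excl = contradiction q (excl p)
  χ-⊎ (yes _) (no _) _ = refl
  χ-⊎ (no _) (yes _) _ = refl
  χ-⊎ (no _) (no _) _ = refl

  χ-cong : (d : Dec P) (e : Dec Q) → (P → Q) → (Q → P) → χ d ≡ χ e
  χ-cong (yes _) (yes _) _ _ = refl
  χ-cong (yes p) (no ¬q) to _ = contradiction (to p) ¬q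
  χ-cong (no ¬p) (yes q) _ from = contradiction (from q) ¬p
  χ-cong (no _) (no _) _ _ = refl

module _ {a} {A : Set a} where

  ∑ : List A → (A → ℕ) → ℕ
  ∑ [] f = 0
  ∑ (x ∷ xs) f = f x + ∑ xs f

  syntax ∑ xs (λ x → e) = ∑[ x ∈ xs ] e

  ∑-cong : ∀ xs {f g : A → ℕ} → (∀ x → f x ≡ g x) → ∑ xs f ≡ ∑ xs g
  ∑-cong [] _ = refl
  ∑-cong (x ∷ xs) f≗g = cong₂ _+_ (f≗g x) (∑-cong xs f≗g)

  ∑-mono : ∀ xs {f g : A → ℕ} → (∀ {x} → x ∈ xs → f x ≤ g x) → ∑ xs f ≤ ∑ xs g
  ∑-mono [] _ = z≤n
  ∑-mono (x ∷ xs) f≤g = +-mono-≤ (f≤g (here refl)) (∑-mono xs (f≤g ∘ there))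

  ∈⇒≤∑ : ∀ {x xs} (f : A → ℕ) → x ∈ xs → f x ≤ ∑ xs f
  ∈⇒≤∑ {xs = y ∷ ys} f (here refl) = m≤m+n (f y) (∑ ys f)
  ∈⇒≤∑ {xs = y ∷ ys} f (there x∈) = ≤-trans (∈⇒≤∑ f x∈) (m≤n+m (∑ ys f) (f y))

  ∑-const : ∀ xs m → ∑ xs (λ _ → m) ≡ m * length xs
  ∑-const [] m = sym (*-zeroʳ m)
  ∑-const (x ∷ xs) m = trans (cong (m +_) (∑-const xs m)) (sym (*-suc m (length xs)))

  ∑-+ : ∀ xs (f g : A → ℕ) → ∑[ x ∈ xs ] (f x + g x) ≡ ∑ xs f + ∑ xs g
  ∑-+ [] f g = refl
  ∑-+ (x ∷ xs) f g = trans (cong (f x + g x +_) (∑-+ xs f g)) (+-shuffle (f x) (g x) (∑ xs f) (∑ xs g))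
    where
    +-shuffle : ∀ a b c d → a + b + (c + d) ≡ a + c + (b + d)
    +-shuffle = solve-∀

  ∑-*ˡ : ∀ xs m (f : A → ℕ) → ∑[ x ∈ xs ] (m * f x) ≡ m * ∑ xs f
  ∑-*ˡ [] m f = sym (*-zeroʳ m)
  ∑-*ˡ (x ∷ xs) m f = trans (cong (m * f x +_) (∑-*ˡ xs m f)) (sym (*-distribˡ-+ m (f x) (∑ xs f)))

  ∑-*ʳ : ∀ xs m (f : A → ℕ) → ∑[ x ∈ xs ] (f x * m) ≡ ∑ xs f * m
  ∑-*ʳ xs m f = trans (∑-cong xs (λ x → *-comm (f x) m)) (trans (∑-*ˡ xs m f) (*-comm m (∑ xs f)))

  ∑-++ : ∀ xs ys (f : A → ℕ) → ∑ (xs ++ ys) f ≡ ∑ xs f + ∑ ys f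
  ∑-++ [] ys f = refl
  ∑-++ (x ∷ xs) ys f = trans (cong (f x +_) (∑-++ xs ys f)) (sym (+-assoc (f x) (∑ xs f) (∑ ys f)))

module _ {a b} {A : Set a} {B : Set b} where

  ∑-map : ∀ (g : A → B) xs (f : B → ℕ) → ∑ (map g xs) f ≡ ∑[ x ∈ xs ] f (g x)
  ∑-map g [] f = refl
  ∑-map g (x ∷ xs) f = cong (f (g x) +_) (∑-map g xs f)

  ∑-concatMap : ∀ (h : A → List B) xs (f : B → ℕ) → ∑ (concatMap h xs) f ≡ ∑[ x ∈ xs ] ∑ (h x) f
  ∑-concatMap h [] f = refl
  ∑-concatMap h (x ∷ xs) f = trans (∑-++ (h x) (concatMap h xs) f) (cong (∑ (h x) f +_) (∑-concatMap h xs f))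

  ∑-swap : ∀ xs ys (f : A → B → ℕ) → ∑[ x ∈ xs ] ∑[ y ∈ ys ] f x y ≡ ∑[ y ∈ ys ] ∑[ x ∈ xs ] f x y
  ∑-swap [] ys f = sym (trans (∑-const ys 0) (*-zeroˡ (length ys)))
  ∑-swap (x ∷ xs) ys f = begin
    ∑ ys (f x) + ∑[ x ∈ xs ] ∑ ys (f x)            ≡⟨ cong (∑ ys (f x) +_) (∑-swap xs ys f) ⟩
    ∑ ys (f x) + ∑[ y ∈ ys ] ∑[ x ∈ xs ] f x y     ≡⟨ ∑-+ ys (f x) (λ y → ∑[ x ∈ xs ] f x y) ⟨
    ∑[ y ∈ ys ] (f x y + ∑[ x ∈ xs ] f x y)        ∎
    where open ≡-Reasoning

distinct-∈⇒2≤length : ∀ {a} {A : Set a} {x y : A} {xs} → x ∈ xs → y ∈ xs → ¬ x ≡ y → 2 ≤ length xs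
distinct-∈⇒2≤length (here refl) (here refl) x≢y = contradiction refl x≢y
distinct-∈⇒2≤length (here refl) (there y∈) _ = s≤s (∈-length y∈)
distinct-∈⇒2≤length (there x∈) _ _ = s≤s (∈-length x∈)

module _ {a p} {A : Set a} {P : Pred A p} (P? : Decidable P) where

  count : List A → ℕ
  count xs = length (filter P? xs)

  count-∷ : ∀ x xs → count (x ∷ xs) ≡ χ (P? x) + count xs
  count-∷ x xs with P? x
  ... | yes _ = refl
  ... | no _ = refl

  count≡∑χ : ∀ xs → count xs ≡ ∑[ x ∈ xs ] χ (P? x)
  count≡∑χ [] = refl
  count≡∑χ (x ∷ xs) = trans (count-∷ x xs) (cong (χ (P? x) +_) (count≡∑χ xs))

  count+count-∁ : ∀ xs → count xs + length (filter (¬? ∘ P?) xs) ≡ length xs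
  count+count-∁ [] = refl
  count+count-∁ (x ∷ xs) with P? x
  ... | yes _ = cong suc (count+count-∁ xs)
  ... | no _ = trans (+-suc _ _) (cong suc (count+count-∁ xs))

  count-filter-⊇ : ∀ {q} {Q : Pred A q} (Q? : Decidable Q) → (∀ {x} → P x → Q x) →
                   ∀ xs → count (filter Q? xs) ≡ count xs
  count-filter-⊇ Q? P⇒Q [] = refl
  count-filter-⊇ Q? P⇒Q (x ∷ xs) with Q? x
  ... | yes _ = begin
    count (x ∷ filter Q? xs)               ≡⟨ count-∷ x (filter Q? xs) ⟩
    χ (P? x) + count (filter Q? xs)        ≡⟨ cong (χ (P? x) +_) (count-filter-⊇ Q? P⇒Q xs) ⟩
    χ (P? x) + count xs                    ≡⟨ count-∷ x xs ⟨
    count (x ∷ xs)                         ∎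
    where open ≡-Reasoning
  ... | no ¬q = begin
    count (filter Q? xs)                   ≡⟨ count-filter-⊇ Q? P⇒Q xs ⟩
    count xs                               ≡⟨ cong (_+ count xs) (χ-no (P? x) (¬q ∘ P⇒Q)) ⟨
    χ (P? x) + count xs                    ≡⟨ count-∷ x xs ⟨
    count (x ∷ xs)                         ∎
    where open ≡-Reasoning

count-map : ∀ {a b p} {A : Set a} {B : Set b} {P : Pred B p} (P? : Decidable P) (f : A → B) xs →
            count P? (map f xs) ≡ count (P? ∘ f) xs
count-map P? f xs = begin
  count P? (map f xs)                ≡⟨ count≡∑χ P? (map f xs) ⟩
  ∑[ y ∈ map f xs ] χ (P? y)         ≡⟨ ∑-map f xs (χ ∘ P?) ⟩
  ∑[ x ∈ xs ] χ (P? (f x))           ≡⟨ count≡∑χ (P? ∘ f) xs ⟨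
  count (P? ∘ f) xs                  ∎
  where open ≡-Reasoning

module _ {a} {A : Set a} (_≟_ : DecidableEquality A) where

  ∈⇒1≤count : ∀ {x ys} → x ∈ ys → 1 ≤ count (_≟ x) ys
  ∈⇒1≤count {x} x∈ys = filter-some (_≟ x) (Any.map sym x∈ys)

  unique⇒count≤1 : ∀ {y xs} → Unique xs → count (y ≟_) xs ≤ 1
  unique⇒count≤1 {xs = []} [] = z≤n
  unique⇒count≤1 {y} {x ∷ xs} (x∉xs ∷ !xs) with y ≟ x
  ... | yes refl = s≤s (≤-reflexive (cong length (filter-none (y ≟_) x∉xs)))
  ... | no _ = unique⇒count≤1 !xs

  ∑-count≤length : ∀ {xs} ys → Unique xs → ∑[ x ∈ xs ] count (_≟ x) ys ≤ length ys
  ∑-count≤length {xs} [] _ = ≤-reflexive (trans (∑-const xs 0) (*-zeroˡ (length xs)))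
  ∑-count≤length {xs} (y ∷ ys) !xs = begin
    ∑[ x ∈ xs ] count (_≟ x) (y ∷ ys)                         ≡⟨ ∑-cong xs (λ x → count-∷ (_≟ x) y ys) ⟩
    ∑[ x ∈ xs ] (χ (y ≟ x) + count (_≟ x) ys)                 ≡⟨ ∑-+ xs (λ x → χ (y ≟ x)) (λ x → count (_≟ x) ys) ⟩
    ∑[ x ∈ xs ] χ (y ≟ x) + ∑[ x ∈ xs ] count (_≟ x) ys       ≡⟨ cong (_+ _) (count≡∑χ (y ≟_) xs) ⟨
    count (y ≟_) xs + ∑[ x ∈ xs ] count (_≟ x) ys             ≤⟨ +-mono-≤ (unique⇒count≤1 !xs) (∑-count≤length ys !xs) ⟩
    suc (length ys)                                           ∎
    where open ≤-Reasoning

  unique-multiplicity : ∀ {xs ys} m → Unique xs → (∀ {x} → x ∈ xs → m ≤ count (_≟ x) ys) →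
                        m * length xs ≤ length ys
  unique-multiplicity {xs} {ys} m !xs m≤count = begin
    m * length xs                     ≡⟨ ∑-const xs m ⟨
    ∑[ x ∈ xs ] m                     ≤⟨ ∑-mono xs m≤count ⟩
    ∑[ x ∈ xs ] count (_≟ x) ys       ≤⟨ ∑-count≤length ys !xs ⟩
    length ys                         ∎
    where open ≤-Reasoning

  unique-⊆⇒length≤ : ∀ {xs ys} → Unique xs → (∀ {x} → x ∈ xs → x ∈ ys) → length xs ≤ length ys
  unique-⊆⇒length≤ {xs} {ys} !xs xs⊆ys =
    ≤-trans (≤-reflexive (sym (*-identityˡ (length xs)))) (unique-multiplicity {ys = ys} 1 !xs (∈⇒1≤count ∘ xs⊆ys))

∑∑-symmetric : ∀ {n} (f : Fin n → Fin n → ℕ) → (∀ u w → f u w ≡ f w u) → (∀ u → f u u ≡ 0) → ∀ xs →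
               ∑[ u ∈ xs ] ∑[ w ∈ xs ] f u w ≡ 2 * ∑[ u ∈ xs ] ∑[ w ∈ xs ] (χ (toℕ u <? toℕ w) * f u w)
∑∑-symmetric {n} f f-sym f-diag xs = begin
  ∑[ u ∈ xs ] ∑[ w ∈ xs ] f u w                                   ≡⟨ ∑-cong xs (λ u → ∑-cong xs (split u)) ⟩
  ∑[ u ∈ xs ] ∑[ w ∈ xs ] (lt u w * f u w + lt w u * f w u)       ≡⟨ ∑-cong xs (λ u → ∑-+ xs _ _) ⟩
  ∑[ u ∈ xs ] (L u + ∑[ w ∈ xs ] (lt w u * f w u))                 ≡⟨ ∑-+ xs L _ ⟩
  ∑ xs L + ∑[ u ∈ xs ] ∑[ w ∈ xs ] (lt w u * f w u)               ≡⟨ cong (∑ xs L +_) (∑-swap xs xs (λ u w → lt w u * f w u)) ⟩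
  ∑ xs L + ∑ xs L                                                 ≡⟨ cong (∑ xs L +_) (+-identityʳ (∑ xs L)) ⟨
  2 * ∑ xs L                                                      ∎
  where
  open ≡-Reasoning
  lt : Fin n → Fin n → ℕ
  lt u w = χ (toℕ u <? toℕ w)
  L : Fin n → ℕ
  L u = ∑[ w ∈ xs ] (lt u w * f u w)
  split : ∀ u w → f u w ≡ lt u w * f u w + lt w u * f w u
  split u w with <-cmp (toℕ u) (toℕ w)
  ... | tri< u<w _ w≮u rewrite χ-yes (toℕ u <? toℕ w) u<w | χ-no (toℕ w <? toℕ u) w≮u =
    sym (trans (+-identityʳ _) (+-identityʳ (f u w)))
  ... | tri≈ _ u≡w _ rewrite Fin.toℕ-injective u≡w | f-diag w = sym (cong₂ _+_ (*-zeroʳ (lt w w)) (*-zeroʳ (lt w w)))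
  ... | tri> u≮w _ w<u rewrite χ-no (toℕ u <? toℕ w) u≮w | χ-yes (toℕ w <? toℕ u) w<u =
    trans (f-sym u w) (sym (+-identityʳ (f w u)))

pair-arith : ∀ {a b ρ s} → a ≤ 1 → b ≤ 1 → ρ + s ≤ 1 → a * ρ + b * ρ + a * b * s ≤ a * b + ρ
pair-arith {ρ = ρ} z≤n z≤n _ = z≤n
pair-arith {ρ = 0} {s} z≤n (s≤s z≤n) _ = z≤n
pair-arith {ρ = 1} z≤n (s≤s z≤n) _ = ≤-refl
pair-arith {ρ = 0} {s} (s≤s z≤n) z≤n _ = z≤n
pair-arith {ρ = 1} (s≤s z≤n) z≤n _ = ≤-refl
pair-arith {ρ = 0} {0} (s≤s z≤n) (s≤s z≤n) _ = z≤n
pair-arith {ρ = 0} {1} (s≤s z≤n) (s≤s z≤n) _ = ≤-refl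
pair-arith {ρ = 1} {0} (s≤s z≤n) (s≤s z≤n) _ = ≤-refl
pair-arith {ρ = 0} {suc (suc _)} _ _ (s≤s ())
pair-arith {ρ = 1} {suc _} _ _ (s≤s ())
pair-arith {ρ = suc (suc _)} _ _ (s≤s ())

counting⇒k≤R : ∀ {n k t p W R} → 1 ≤ k →
               t * (n + k) ≤ 2 * (t * (1 + p) + W) → 2 * W + t ≤ t * t + 2 * R →
               t + 2 * p < n → n + k ≤ 2 * (t + p) → k ≤ R
counting⇒k≤R {n} {k} {t} {p} {W} {R} 1≤k degrees pairs t+2p<n n+k≤2[t+p] =
  *-cancelˡ-≤ 2 (≤-trans (*-monoˡ-≤ k 2≤t) tk≤2R)
  where
  open ≤-Reasoning
  tk≤2R : t * k ≤ 2 * R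
  tk≤2R = +-cancelˡ-≤ (t * (n + 1)) _ _ (begin
    t * (n + 1) + t * k                     ≡⟨ e₁ t n k ⟩
    t * (n + k) + t                         ≤⟨ +-monoˡ-≤ t degrees ⟩
    2 * (t * (1 + p) + W) + t               ≡⟨ e₂ t p W ⟩
    2 * (t * (1 + p)) + (2 * W + t)         ≤⟨ +-monoʳ-≤ (2 * (t * (1 + p))) pairs ⟩
    2 * (t * (1 + p)) + (t * t + 2 * R)     ≡⟨ e₃ t p R ⟩
    t * suc (t + 2 * p) + t + 2 * R         ≤⟨ +-monoˡ-≤ (2 * R) (+-monoˡ-≤ t (*-monoʳ-≤ t t+2p<n)) ⟩
    t * n + t + 2 * R                       ≡⟨ cong (_+ 2 * R) (e₄ t n) ⟩
    t * (n + 1) + 2 * R                     ∎)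
    where
    e₁ : ∀ t n k → t * (n + 1) + t * k ≡ t * (n + k) + t
    e₁ = solve-∀
    e₂ : ∀ t p W → 2 * (t * (1 + p) + W) + t ≡ 2 * (t * (1 + p)) + (2 * W + t)
    e₂ = solve-∀
    e₃ : ∀ t p R → 2 * (t * (1 + p)) + (t * t + 2 * R) ≡ t * suc (t + 2 * p) + t + 2 * R
    e₃ = solve-∀
    e₄ : ∀ t n → t * n + t ≡ t * (n + 1)
    e₄ = solve-∀
  2≤t : 2 ≤ t
  2≤t = +-cancelʳ-≤ (n + t + 2 * p) 2 t (begin
    2 + (n + t + 2 * p)                     ≤⟨ +-monoˡ-≤ (n + t + 2 * p) (s≤s 1≤k) ⟩
    suc k + (n + t + 2 * p)                 ≡⟨ e₅ n k t p ⟩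
    n + k + suc (t + 2 * p)                 ≤⟨ +-mono-≤ n+k≤2[t+p] t+2p<n ⟩
    2 * (t + p) + n                         ≡⟨ e₆ t p n ⟩
    t + (n + t + 2 * p)                     ∎)
    where
    e₅ : ∀ n k t p → suc k + (n + t + 2 * p) ≡ n + k + suc (t + 2 * p)
    e₅ = solve-∀
    e₆ : ∀ t p n → 2 * (t + p) + n ≡ t + (n + t + 2 * p)
    e₆ = solve-∀

∈-others⁺ : ∀ {n} {v w : Fin n} → ¬ w ≡ v → w ∈ others v
∈-others⁺ {v = v} {w} w≢v = ∈-filter⁺ (λ u → ¬? (u Fin.≟ v)) (∈-allFin w) w≢v

∈-others⁻ : ∀ {n} {v w : Fin n} → w ∈ others v → ¬ w ≡ v
∈-others⁻ {n} {v} w∈ = proj₂ (∈-filter⁻ (λ u → ¬? (u Fin.≟ v)) {xs = allFin n} w∈)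

length-others : ∀ {n} (v : Fin n) → length (others v) < n
length-others {n} v = subst (length (others v) <_) (length-tabulate id)
  (filter-notAll (λ u → ¬? (u Fin.≟ v)) (allFin n) (Any.map (λ v≡u u≢v → u≢v (sym v≡u)) (∈-allFin v)))

module AtVertex {n} (c : EdgeColoring n) (v : Fin n) where

  N : List (Fin n)
  N = others v

  multiplicity : ℕ → ℕ
  multiplicity a = count (λ w → col c v w ≟ a) N

  Lone : Fin n → Set
  Lone u = multiplicity (col c v u) ≤ 1

  lone? : Decidable Lone
  lone? u = multiplicity (col c v u) ≤? 1

  lone : List (Fin n)
  lone = filter lone? N

  repeatedColours : List ℕ
  repeatedColours = deduplicate _≟_ (map (col c v) (filter (¬? ∘ lone?) N))

  t p : ℕ
  t = length lone
  p = length repeatedColours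

  lone-colour : ∀ {u w} → u ∈ N → Lone u → w ∈ N → ¬ w ≡ u → ¬ col c v w ≡ col c v u
  lone-colour {u} {w} u∈N lone-u w∈N w≢u same = <⇒≱ two-with-colour lone-u
    where
    two-with-colour : 2 ≤ multiplicity (col c v u)
    two-with-colour = distinct-∈⇒2≤length (∈-filter⁺ (λ z → col c v z ≟ col c v u) u∈N refl)
                                          (∈-filter⁺ (λ z → col c v z ≟ col c v u) w∈N same) (w≢u ∘ sym)

  colorDegree≤t+p : colorDegree c v ≤ t + p
  colorDegree≤t+p = begin
    colorDegree c v                                 ≤⟨ unique-⊆⇒length≤ _≟_ (deduplicate-! _≟_ _) covered ⟩
    length (map (col c v) lone ++ repeatedColours)  ≡⟨ length-++ (map (col c v) lone) ⟩
    length (map (col c v) lone) + p                 ≡⟨ cong (_+ p) (length-map (col c v) lone) ⟩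
    t + p                                           ∎
    where
    open ≤-Reasoning
    covered : ∀ {a} → a ∈ deduplicate _≟_ (map (col c v) N) → a ∈ map (col c v) lone ++ repeatedColours
    covered a∈ with ∈-map⁻ (col c v) (∈-deduplicate⁻ _≟_ (map (col c v) N) a∈)
    ... | w , w∈N , refl with lone? w
    ... | yes lone-w = ∈-++⁺ˡ (∈-map⁺ (col c v) (∈-filter⁺ lone? w∈N lone-w))
    ... | no ¬lone-w = ∈-++⁺ʳ (map (col c v) lone)
            (∈-deduplicate⁺ _≟_ (∈-map⁺ (col c v) (∈-filter⁺ (¬? ∘ lone?) w∈N ¬lone-w)))

  t+2p<n : t + 2 * p < n
  t+2p<n = begin-strict
    t + 2 * p                         ≤⟨ +-monoʳ-≤ t (≤-trans 2p≤ (≤-reflexive (length-map (col c v) repeated))) ⟩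
    t + length repeated               ≡⟨ count+count-∁ lone? N ⟩
    length N                          <⟨ length-others v ⟩
    n                                 ∎
    where
    open ≤-Reasoning
    repeated : List (Fin n)
    repeated = filter (¬? ∘ lone?) N
    twice : ∀ {a} → a ∈ repeatedColours → 2 ≤ count (_≟ a) (map (col c v) repeated)
    twice a∈ with ∈-map⁻ (col c v) (∈-deduplicate⁻ _≟_ (map (col c v) repeated) a∈)
    ... | x , x∈ , refl = begin
      2                                                       ≤⟨ ≰⇒> (proj₂ (∈-filter⁻ (¬? ∘ lone?) {xs = N} x∈)) ⟩
      multiplicity (col c v x)                                ≡⟨ count-filter-⊇ _ (¬? ∘ lone?) not-lone N ⟨
      count (λ w → col c v w ≟ col c v x) repeated            ≡⟨ count-map (_≟ col c v x) (col c v) repeated ⟨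
      count (_≟ col c v x) (map (col c v) repeated)           ∎
      where
      not-lone : ∀ {w} → col c v w ≡ col c v x → ¬ Lone w
      not-lone same rewrite same = proj₂ (∈-filter⁻ (¬? ∘ lone?) {xs = N} x∈)
    2p≤ : 2 * p ≤ length (map (col c v) repeated)
    2p≤ = unique-multiplicity _≟_ {ys = map (col c v) repeated} 2 (deduplicate-! _≟_ _) twice

  Rainbow : Fin n → Fin n → Set
  Rainbow u w = ¬ col c v u ≡ col c v w × ¬ col c v u ≡ col c u w × ¬ col c v w ≡ col c u w

  rainbow? : ∀ u w → Dec (Rainbow u w)
  rainbow? u w = ¬? (col c v u ≟ col c v w) ×-dec ¬? (col c v u ≟ col c u w) ×-dec ¬? (col c v w ≟ col c u w)

  -- The first component also rules out w = u, where col c u w is meaningless.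
  Copies : Fin n → Fin n → Set
  Copies u w = ¬ col c v w ≡ col c v u × col c u w ≡ col c v w

  copies? : ∀ u w → Dec (Copies u w)
  copies? u w = ¬? (col c v w ≟ col c v u) ×-dec (col c u w ≟ col c v w)

  loneCopy? : ∀ u w → Dec (Lone w × Copies u w)
  loneCopy? u w = lone? w ×-dec copies? u w

  rainbows loneCopies : Fin n → ℕ
  rainbows u = count (rainbow? u) N
  loneCopies u = count (loneCopy? u) N

  lone-edge-cases : ∀ {u w} → u ∈ N → Lone u → w ∈ N → ¬ w ≡ u →
                    Rainbow u w ⊎ col c u w ≡ col c u v ⊎ Copies u w
  lone-edge-cases {u} {w} u∈N lone-u w∈N w≢u with rainbow? u w | col c u w ≟ col c u v
  ... | yes rainbow | _ = inj₁ rainbow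
  ... | no _ | yes same = inj₂ (inj₁ same)
  ... | no ¬rainbow | no ¬same = inj₂ (inj₂ ((vu≢vw ∘ sym) , sym vw≡uw))
    where
    vu≢vw : ¬ col c v u ≡ col c v w
    vu≢vw = lone-colour u∈N lone-u w∈N w≢u ∘ sym
    vu≢uw : ¬ col c v u ≡ col c u w
    vu≢uw vu≡uw = ¬same (trans (sym vu≡uw) (EdgeColoring.sym c v u (∈-others⁻ u∈N ∘ sym)))
    vw≡uw : col c v w ≡ col c u w
    vw≡uw = decidable-stable (col c v w ≟ col c u w) (λ vw≢uw → ¬rainbow (vu≢vw , vu≢uw , vw≢uw))

  colorDegree-lone : ∀ {u} → u ∈ N → Lone u → colorDegree c u ≤ 1 + (rainbows u + (loneCopies u + p))
  colorDegree-lone {u} u∈N lone-u = begin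
    colorDegree c u                          ≤⟨ unique-⊆⇒length≤ _≟_ (deduplicate-! _≟_ _) covered ⟩
    length colours                           ≡⟨ cong suc (trans (length-++ R) (cong (length R +_) (length-++ C))) ⟩
    1 + (length R + (length C + p))          ≡⟨ cong₂ (λ r i → 1 + (r + (i + p))) (length-map (col c u) (filter (rainbow? u) N))
                                                  (length-map (col c u) (filter (loneCopy? u) N)) ⟩
    1 + (rainbows u + (loneCopies u + p))    ∎
    where
    open ≤-Reasoning
    R C colours : List ℕ
    R = map (col c u) (filter (rainbow? u) N)
    C = map (col c u) (filter (loneCopy? u) N)
    colours = col c u v ∷ R ++ C ++ repeatedColours
    colour-of : ∀ w → ¬ w ≡ u → col c u w ∈ colours
    colour-of w w≢u with w Fin.≟ v
    ... | yes refl = here refl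
    ... | no w≢v with lone-edge-cases u∈N lone-u (∈-others⁺ w≢v) w≢u | lone? w
    ... | inj₁ rainbow | _ = there (∈-++⁺ˡ (∈-map⁺ (col c u) (∈-filter⁺ (rainbow? u) (∈-others⁺ w≢v) rainbow)))
    ... | inj₂ (inj₁ same) | _ = here same
    ... | inj₂ (inj₂ copy) | yes lone-w =
      there (∈-++⁺ʳ R (∈-++⁺ˡ (∈-map⁺ (col c u) (∈-filter⁺ (loneCopy? u) (∈-others⁺ w≢v) (lone-w , copy)))))
    ... | inj₂ (inj₂ copy) | no ¬lone-w =
      there (∈-++⁺ʳ R (∈-++⁺ʳ C (subst (_∈ repeatedColours) (sym (proj₂ copy))
        (∈-deduplicate⁺ _≟_ (∈-map⁺ (col c v) (∈-filter⁺ (¬? ∘ lone?) (∈-others⁺ w≢v) ¬lone-w))))))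
    covered : ∀ {a} → a ∈ deduplicate _≟_ (map (col c u) (others u)) → a ∈ colours
    covered a∈ with ∈-map⁻ (col c u) (∈-deduplicate⁻ _≟_ (map (col c u) (others u)) a∈)
    ... | w , w∈ , refl = colour-of w (∈-others⁻ w∈)

  col-sym : ∀ {u w} → ¬ col c v u ≡ col c v w → col c u w ≡ col c w u
  col-sym {u} {w} vu≢vw = EdgeColoring.sym c u w (vu≢vw ∘ cong (col c v))

  rainbow-sym : ∀ {u w} → Rainbow u w → Rainbow w u
  rainbow-sym (vu≢vw , vu≢uw , vw≢uw) =
    (vu≢vw ∘ sym) , (λ e → vw≢uw (trans e (col-sym (vu≢vw ∘ sym)))) , (λ e → vu≢uw (trans e (col-sym (vu≢vw ∘ sym))))

  χrainbow-sym : ∀ u w → χ (rainbow? u w) ≡ χ (rainbow? w u)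
  χrainbow-sym u w = χ-cong (rainbow? u w) (rainbow? w u) rainbow-sym rainbow-sym

  not-rainbow-self : ∀ u → ¬ Rainbow u u
  not-rainbow-self u (vu≢vu , _) = vu≢vu refl

  twice-rainbowTriangles : 2 * rainbowTrianglesAt c v ≡ ∑[ u ∈ N ] ∑[ w ∈ N ] χ (rainbow? u w)
  twice-rainbowTriangles = begin
    2 * rainbowTrianglesAt c v                                                 ≡⟨ cong (2 *_) pairs ⟩
    2 * ∑[ u ∈ N ] ∑[ w ∈ N ] (χ (toℕ u <? toℕ w) * χ (rainbow? u w))          ≡⟨ ∑∑-symmetric (λ u w → χ (rainbow? u w)) χrainbow-sym
                                                                                    (λ u → χ-no (rainbow? u u) (not-rainbow-self u)) N ⟨
    ∑[ u ∈ N ] ∑[ w ∈ N ] χ (rainbow? u w)                                     ∎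
    where
    open ≡-Reasoning
    pairs : rainbowTrianglesAt c v ≡ ∑[ u ∈ N ] ∑[ w ∈ N ] (χ (toℕ u <? toℕ w) * χ (rainbow? u w))
    pairs = begin
      rainbowTrianglesAt c v     ≡⟨ count≡∑χ _ (concatMap (λ u → map (u ,_) N) N) ⟩
      _                          ≡⟨ ∑-concatMap (λ u → map (u ,_) N) N _ ⟩
      _                          ≡⟨ ∑-cong N (λ u → ∑-map (u ,_) N _) ⟩
      _                          ≡⟨ ∑-cong N (λ u → ∑-cong N (λ w → χ-× (toℕ u <? toℕ w) (rainbow? u w))) ⟩
      _                          ∎

  χlone : Fin n → ℕ
  χlone u = χ (lone? u)

  ∑∑ : (Fin n → Fin n → ℕ) → ℕ
  ∑∑ f = ∑[ u ∈ N ] ∑[ w ∈ N ] f u w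

  ∑∑-+ : ∀ f g → ∑∑ (λ u w → f u w + g u w) ≡ ∑∑ f + ∑∑ g
  ∑∑-+ f g = trans (∑-cong N (λ u → ∑-+ N (f u) (g u))) (∑-+ N _ _)

  t≡∑χlone : t ≡ ∑ N χlone
  t≡∑χlone = count≡∑χ lone? N

  t*t≡∑∑ : t * t ≡ ∑∑ (λ u w → χlone u * χlone w)
  t*t≡∑∑ = begin
    t * t                                  ≡⟨ cong (_* t) t≡∑χlone ⟩
    ∑ N χlone * t                          ≡⟨ ∑-*ʳ N t χlone ⟨
    ∑[ u ∈ N ] (χlone u * t)               ≡⟨ ∑-cong N (λ u → cong (χlone u *_) t≡∑χlone) ⟩
    ∑[ u ∈ N ] (χlone u * ∑ N χlone)       ≡⟨ ∑-cong N (λ u → ∑-*ˡ N (χlone u) χlone) ⟨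
    ∑∑ (λ u w → χlone u * χlone w)         ∎
    where open ≡-Reasoning

  t≤∑∑diagonal : t ≤ ∑∑ (λ u w → χ (u Fin.≟ w) * (χlone u * χlone w))
  t≤∑∑diagonal = begin
    t                                      ≡⟨ t≡∑χlone ⟩
    ∑ N χlone                              ≤⟨ ∑-mono N diagonal-term ⟩
    ∑∑ (λ u w → χ (u Fin.≟ w) * (χlone u * χlone w)) ∎
    where
    open ≤-Reasoning
    diagonal-term : ∀ {u} → u ∈ N → χlone u ≤ ∑[ w ∈ N ] (χ (u Fin.≟ w) * (χlone u * χlone w))
    diagonal-term {u} u∈N = begin
      χlone u                                       ≡⟨ χ*χ (lone? u) ⟨
      χlone u * χlone u                             ≡⟨ +-identityʳ _ ⟨
      1 * (χlone u * χlone u)                       ≡⟨ cong (_* (χlone u * χlone u)) (χ-yes (u Fin.≟ u) refl) ⟨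
      χ (u Fin.≟ u) * (χlone u * χlone u)           ≤⟨ ∈⇒≤∑ (λ w → χ (u Fin.≟ w) * (χlone u * χlone w)) u∈N ⟩
      ∑[ w ∈ N ] (χ (u Fin.≟ w) * (χlone u * χlone w)) ∎

  at-most-one : ∀ u w → χ (rainbow? u w) + (χ (copies? u w) + (χ (copies? w u) + χ (u Fin.≟ w))) ≤ 1
  at-most-one u w = begin
    χ (rainbow? u w) + (χ (copies? u w) + (χ (copies? w u) + χ (u Fin.≟ w)))
      ≡⟨ cong (λ x → χ (rainbow? u w) + (χ (copies? u w) + x)) (χ-⊎ (copies? w u) (u Fin.≟ w) copy′⇒≢) ⟨
    χ (rainbow? u w) + (χ (copies? u w) + χ copy′-or-equal)
      ≡⟨ cong (χ (rainbow? u w) +_) (χ-⊎ (copies? u w) copy′-or-equal copy⇒¬) ⟨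
    χ (rainbow? u w) + χ (copies? u w ⊎-dec copy′-or-equal)
      ≡⟨ χ-⊎ (rainbow? u w) (copies? u w ⊎-dec copy′-or-equal) rainbow⇒¬ ⟨
    χ (rainbow? u w ⊎-dec (copies? u w ⊎-dec copy′-or-equal))
      ≤⟨ χ≤1 (rainbow? u w ⊎-dec (copies? u w ⊎-dec copy′-or-equal)) ⟩
    1 ∎
    where
    open ≤-Reasoning
    copy′-or-equal : Dec (Copies w u ⊎ u ≡ w)
    copy′-or-equal = copies? w u ⊎-dec u Fin.≟ w
    copy′⇒≢ : Copies w u → ¬ u ≡ w
    copy′⇒≢ (vu≢vw , _) u≡w = vu≢vw (cong (col c v) u≡w)
    copy⇒¬ : Copies u w → ¬ (Copies w u ⊎ u ≡ w)
    copy⇒¬ (vw≢vu , uw≡vw) (inj₁ (_ , wu≡vu)) =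
      vw≢vu (trans (sym uw≡vw) (trans (col-sym (vw≢vu ∘ sym)) wu≡vu))
    copy⇒¬ (vw≢vu , _) (inj₂ u≡w) = vw≢vu (cong (col c v) (sym u≡w))
    rainbow⇒¬ : Rainbow u w → ¬ (Copies u w ⊎ (Copies w u ⊎ u ≡ w))
    rainbow⇒¬ (_ , _ , vw≢uw) (inj₁ (_ , uw≡vw)) = vw≢uw (sym uw≡vw)
    rainbow⇒¬ (vu≢vw , vu≢uw , _) (inj₂ (inj₁ (_ , wu≡vu))) =
      vu≢uw (trans (sym wu≡vu) (col-sym (vu≢vw ∘ sym)))
    rainbow⇒¬ (vu≢vw , _) (inj₂ (inj₂ u≡w)) = vu≢vw (cong (col c v) u≡w)

  weight : Fin n → Fin n → ℕ
  weight u w = χlone u * (χ (rainbow? u w) + χlone w * χ (copies? u w))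

  totalWeight : ℕ
  totalWeight = ∑[ u ∈ N ] (χlone u * (rainbows u + loneCopies u))

  totalWeight≡∑∑weight : totalWeight ≡ ∑∑ weight
  totalWeight≡∑∑weight = ∑-cong N (λ u → begin
    χlone u * (rainbows u + loneCopies u)
      ≡⟨ cong (χlone u *_) (cong₂ _+_ (count≡∑χ (rainbow? u) N) (count≡∑χ (loneCopy? u) N)) ⟩
    χlone u * (∑[ w ∈ N ] χ (rainbow? u w) + ∑[ w ∈ N ] χ (loneCopy? u w))
      ≡⟨ cong (χlone u *_) (∑-+ N _ _) ⟨
    χlone u * ∑[ w ∈ N ] (χ (rainbow? u w) + χ (loneCopy? u w))
      ≡⟨ cong (χlone u *_) (∑-cong N (λ w → cong (χ (rainbow? u w) +_) (χ-× (lone? w) (copies? u w)))) ⟩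
    χlone u * ∑[ w ∈ N ] (χ (rainbow? u w) + χlone w * χ (copies? u w))
      ≡⟨ ∑-*ˡ N (χlone u) _ ⟨
    ∑[ w ∈ N ] weight u w ∎)
    where open ≡-Reasoning

  pair-bound : ∀ u w → weight u w + weight w u + χ (u Fin.≟ w) * (χlone u * χlone w) ≤ χlone u * χlone w + χ (rainbow? u w)
  pair-bound u w = begin
    weight u w + weight w u + δ * (a * b)              ≡⟨ cong (λ ρ′ → weight u w + b * (ρ′ + a * ι′) + δ * (a * b)) (χrainbow-sym u w) ⟨
    a * (ρ + b * ι) + b * (ρ + a * ι′) + δ * (a * b)   ≡⟨ regroup a b ρ ι ι′ δ ⟩
    a * ρ + b * ρ + a * b * (ι + (ι′ + δ))             ≤⟨ pair-arith (χ≤1 (lone? u)) (χ≤1 (lone? w)) (at-most-one u w) ⟩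
    a * b + ρ                                          ∎
    where
    open ≤-Reasoning
    a b ρ ι ι′ δ : ℕ
    a = χlone u
    b = χlone w
    ρ = χ (rainbow? u w)
    ι = χ (copies? u w)
    ι′ = χ (copies? w u)
    δ = χ (u Fin.≟ w)
    regroup : ∀ a b ρ ι ι′ δ → a * (ρ + b * ι) + b * (ρ + a * ι′) + δ * (a * b) ≡ a * ρ + b * ρ + a * b * (ι + (ι′ + δ))
    regroup = solve-∀

  lone-pair-count : 2 * totalWeight + t ≤ t * t + 2 * rainbowTrianglesAt c v
  lone-pair-count = begin
    2 * totalWeight + t                                               ≡⟨ cong (_+ t) twice-totalWeight ⟩
    ∑∑ (λ u w → weight u w + weight w u) + t                          ≤⟨ +-monoʳ-≤ _ t≤∑∑diagonal ⟩
    ∑∑ (λ u w → weight u w + weight w u) + ∑∑ δ                       ≡⟨ ∑∑-+ _ _ ⟨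
    ∑∑ (λ u w → weight u w + weight w u + δ u w)                      ≤⟨ ∑-mono N (λ {u} _ → ∑-mono N (λ {w} _ → pair-bound u w)) ⟩
    ∑∑ (λ u w → χlone u * χlone w + χ (rainbow? u w))                 ≡⟨ ∑∑-+ _ _ ⟩
    ∑∑ (λ u w → χlone u * χlone w) + ∑∑ (λ u w → χ (rainbow? u w))    ≡⟨ cong₂ _+_ t*t≡∑∑ twice-rainbowTriangles ⟨
    t * t + 2 * rainbowTrianglesAt c v                                ∎
    where
    open ≤-Reasoning
    δ : Fin n → Fin n → ℕ
    δ u w = χ (u Fin.≟ w) * (χlone u * χlone w)
    twice-totalWeight : 2 * totalWeight ≡ ∑∑ (λ u w → weight u w + weight w u)
    twice-totalWeight = begin-equality
      2 * totalWeight                         ≡⟨ cong (totalWeight +_) (+-identityʳ totalWeight) ⟩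
      totalWeight + totalWeight               ≡⟨ cong₂ _+_ totalWeight≡∑∑weight (trans totalWeight≡∑∑weight (∑-swap N N weight)) ⟩
      ∑∑ weight + ∑∑ (λ u w → weight w u)     ≡⟨ ∑∑-+ _ _ ⟨
      ∑∑ (λ u w → weight u w + weight w u)    ∎

  lone-degree-sum : ∀ {k} → (∀ u → n + k ≤ 2 * colorDegree c u) → t * (n + k) ≤ 2 * (t * (1 + p) + totalWeight)
  lone-degree-sum {k} n+k≤2d = begin
    t * (n + k)                                                  ≡⟨ cong (_* (n + k)) t≡∑χlone ⟩
    ∑ N χlone * (n + k)                                          ≡⟨ ∑-*ʳ N (n + k) χlone ⟨
    ∑[ u ∈ N ] (χlone u * (n + k))                               ≤⟨ ∑-mono N (λ u∈N → χ-*-mono (lone? _) (bound u∈N)) ⟩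
    ∑[ u ∈ N ] (χlone u * (2 * (1 + (rainbows u + (loneCopies u + p)))))
      ≡⟨ ∑-cong N (λ u → regroup (χlone u) p (rainbows u) (loneCopies u)) ⟩
    ∑[ u ∈ N ] (2 * (χlone u * (1 + p) + χlone u * (rainbows u + loneCopies u)))
      ≡⟨ ∑-*ˡ N 2 _ ⟩
    2 * ∑[ u ∈ N ] (χlone u * (1 + p) + χlone u * (rainbows u + loneCopies u))
      ≡⟨ cong (2 *_) (∑-+ N _ _) ⟩
    2 * (∑[ u ∈ N ] (χlone u * (1 + p)) + totalWeight)
      ≡⟨ cong (λ x → 2 * (x + totalWeight)) (trans (∑-*ʳ N (1 + p) χlone) (cong (_* (1 + p)) (sym t≡∑χlone))) ⟩
    2 * (t * (1 + p) + totalWeight)                              ∎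
    where
    open ≤-Reasoning
    bound : ∀ {u} → u ∈ N → Lone u → n + k ≤ 2 * (1 + (rainbows u + (loneCopies u + p)))
    bound {u} u∈N lone-u = ≤-trans (n+k≤2d u) (*-monoʳ-≤ 2 (colorDegree-lone u∈N lone-u))
    regroup : ∀ a p r i → a * (2 * (1 + (r + (i + p)))) ≡ 2 * (a * (1 + p) + a * (r + i))
    regroup = solve-∀

theorem1p4 : (k n : ℕ) → 1 ≤ k → (c : EdgeColoring n) →
    ((v : Fin n) → n + k ≤ 2 * colorDegree c v) →
    (v : Fin n) → k ≤ rainbowTrianglesAt c v
theorem1p4 k n 1≤k c n+k≤2d v =
  counting⇒k≤R {t = t} {p} {totalWeight} 1≤k
    (lone-degree-sum n+k≤2d) lone-pair-count t+2p<n (≤-trans (n+k≤2d v) (*-monoʳ-≤ 2 colorDegree≤t+p))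
  where open AtVertex c v
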